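{- Let $G$ be a connected graph of order $n(G)$. Then: (i) if $o(G)=\mathcal{R}$, then $\dim(G)\leq \lfloor n(G)/2\rfloor$; (ii) if $\dim(G)\geq \lceil n(G)/2\rceil+1$, then $o(G)=\mathcal{S}$.
   Context: All graphs are finite, simple, undirected and connected with at least two vertices; $d(u,v)$ is the shortest-path distance. A set $W\subseteq V(G)$ is a resolving set of $G$ if for every pair of distinct vertices $x,y$ there is $z\in W$ with $d(x,z)\neq d(y,z)$; $\dim(G)$ is the minimum cardinality of a resolving set. The Maker-Breaker resolving game on $G$ is played by Resolver and Spoiler, who alternately select (without skipping) a vertex of $G$ not yet selected; Resolver wins if at some point the vertices he has selected form a resolving set of $G$, and Spoiler wins if Resolver never achieves this. The R-game is the game in which Resolver moves first, the S-game the one in which Spoiler moves first. The outcome $o(G)$ is $\mathcal{R}$ if Resolver has a winning strategy in both the R-game and the S-game; $\mathcal{S}$ if Spoiler has a winning strategy in both; $\mathcal{N}$ if the first player has a winning strategy (in each game); $\widetilde{\mathcal{N}}$ if the second player has a winning strategy. -}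

module Defs where

open import Data.Nat using (ℕ; zero; suc; _≤_)
open import Data.Fin using (Fin)
open import Data.Fin.Subset using (Subset; _∈_; _∉_; _∪_; ⁅_⁆; ∣_∣; ⊥)
open import Data.Product using (Σ; ∃; ∃-syntax; _×_; _,_)
open import Relation.Nullary using (¬_; Dec)
open import Relation.Binary.PropositionalEquality using (_≡_; _≢_)

record Graph (n : ℕ) : Set₁ where
  field
    Adj    : Fin n → Fin n → Set
    adj?   : ∀ u v → Dec (Adj u v)
    sym    : ∀ {u v} → Adj u v → Adj v u
    irrefl : ∀ {u} → ¬ Adj u u
open Graph public

module _ {n : ℕ} (G : Graph n) where

  data Walk : Fin n → Fin n → ℕ → Set where
    here : ∀ {u} → Walk u u zero
    step : ∀ {u w v k} → Adj G u w → Walk w v k → Walk u v (suc k)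

  Connected : Set
  Connected = ∀ u v → ∃[ k ] Walk u v k

  Dist : Fin n → Fin n → ℕ → Set
  Dist u v k = Walk u v k × (∀ m → Walk u v m → k ≤ m)

  Resolving : Subset n → Set
  Resolving W = ∀ x y → x ≢ y →
    ∃[ z ] (z ∈ W × ∃[ a ] ∃[ b ] (Dist x z a × Dist y z b × a ≢ b))

  IsMetricDim : ℕ → Set
  IsMetricDim d = (∃[ W ] (Resolving W × ∣ W ∣ ≡ d))
                × (∀ W → Resolving W → d ≤ ∣ W ∣)

  data Player : Set where
    resolver spoiler : Player

  Free : Subset n → Subset n → Fin n → Set
  Free R S v = v ∉ R × v ∉ S

  -- RWins R S p : in the position where Resolver has chosen R, Spoiler has
  -- chosen S and p is to move, Resolver has a winning strategy.
  data RWins : Subset n → Subset n → Player → Set where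
    won   : ∀ {R S p} → Resolving R → RWins R S p
    rmove : ∀ {R S} v → Free R S v → RWins (R ∪ ⁅ v ⁆) S spoiler →
            RWins R S resolver
    smove : ∀ {R S} → ∃[ v ] Free R S v →
            (∀ v → Free R S v → RWins R (S ∪ ⁅ v ⁆) resolver) →
            RWins R S spoiler

  -- SWins R S p : Spoiler has a winning strategy from that position
  -- (Resolver's set never becomes resolving; the game ends when all vertices
  -- are chosen, or when the player to move has no available vertex).
  data SWins : Subset n → Subset n → Player → Set where
    over  : ∀ {R S p} → ¬ Resolving R → (∀ v → ¬ Free R S v) → SWins R S p
    smove : ∀ {R S} v → ¬ Resolving R → Free R S v →
            SWins R (S ∪ ⁅ v ⁆) resolver → SWins R S spoiler
    rmove : ∀ {R S} → ¬ Resolving R →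
            (∀ v → Free R S v → SWins (R ∪ ⁅ v ⁆) S spoiler) →
            SWins R S resolver

  -- o(G) = 𝓡 : Resolver wins both the R-game and the S-game.
  OutcomeR : Set
  OutcomeR = RWins ⊥ ⊥ resolver × RWins ⊥ ⊥ spoiler

  -- o(G) = 𝓢 : Spoiler wins both the R-game and the S-game.
  OutcomeS : Set
  OutcomeS = SWins ⊥ ⊥ resolver × SWins ⊥ ⊥ spoiler

-- As the players alternate, Resolver holds at most half of the chosen vertices
-- when Spoiler moved first, and at most half rounded up in general. Hence, if
-- Resolver wins the S-game, some play ends with a resolving set having at most
-- n/2 vertices, so dim(G) ≤ ⌊n/2⌋. Conversely, if dim(G) > ⌈n/2⌉, Resolver
-- never holds enough vertices to resolve G, so Spoiler wins by choosing
-- arbitrary free vertices until none is left.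
module Submission where

open import Defs hiding (sym)
open import Algebra.Bundles using (CommutativeMonoid)
open import Data.Empty using (⊥-elim)
open import Data.Fin using (Fin)
open import Data.Fin.Properties using (any?)
open import Data.Fin.Subset using (Subset; _∉_; _∪_; ⁅_⁆; ∣_∣; ⊥; inside; outside)
open import Data.Fin.Subset.Properties
  using (∣p∣≤n; ∣⊥∣≡0; ∪-identityʳ; ∪-assoc; ∪-commutativeMonoid; x∈p∪q⁻; _∈?_)
open import Data.Nat using (ℕ; zero; suc; _+_; _≤_; _<_; ⌊_/2⌋; ⌈_/2⌉; s≤s; z≤n)
open import Data.Nat.Properties
open import Data.Product using (_×_; _,_; ∃-syntax)
open import Data.Sum using (inj₁; inj₂)
open import Data.Vec using (_∷_)
open import Data.Vec.Base using (here; there)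
open import Function using (_∘_)
open import Relation.Nullary using (Dec; yes; no; ¬_)
open import Relation.Nullary.Decidable using (¬?; _×-dec_)
open import Relation.Binary.PropositionalEquality

k+k≤n⇒k≤⌊n/2⌋ : ∀ {k n} → k + k ≤ n → k ≤ ⌊ n /2⌋
k+k≤n⇒k≤⌊n/2⌋ {k} k+k≤n = subst (_≤ _) (sym (n≡⌊n+n/2⌋ k)) (⌊n/2⌋-mono k+k≤n)

⌈n/2⌉+1≤k⇒1+n<k+k : ∀ {n k} → ⌈ n /2⌉ + 1 ≤ k → suc n < k + k
⌈n/2⌉+1≤k⇒1+n<k+k {n} {k} le = begin-strict
  suc n                             ≡⟨ cong suc (sym (⌊n/2⌋+⌈n/2⌉≡n n)) ⟩
  suc (⌊ n /2⌋ + ⌈ n /2⌉)            ≤⟨ s≤s (+-monoˡ-≤ ⌈ n /2⌉ (⌊n/2⌋≤⌈n/2⌉ n)) ⟩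
  suc (⌈ n /2⌉ + ⌈ n /2⌉)            <⟨ s≤s (≤-reflexive (sym (+-suc ⌈ n /2⌉ ⌈ n /2⌉))) ⟩
  suc ⌈ n /2⌉ + suc ⌈ n /2⌉          ≡⟨ cong (λ m → m + m) (+-comm 1 ⌈ n /2⌉) ⟩
  (⌈ n /2⌉ + 1) + (⌈ n /2⌉ + 1)      ≤⟨ +-mono-≤ le le ⟩
  k + k                             ∎
  where open ≤-Reasoning

x∉p⇒∣p∪⁅x⁆∣≡1+∣p∣ : ∀ {n} {p : Subset n} {x} → x ∉ p → ∣ p ∪ ⁅ x ⁆ ∣ ≡ suc ∣ p ∣
x∉p⇒∣p∪⁅x⁆∣≡1+∣p∣ {p = inside  ∷ p} {x = Fin.zero}  x∉p = ⊥-elim (x∉p here)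
x∉p⇒∣p∪⁅x⁆∣≡1+∣p∣ {p = outside ∷ p} {x = Fin.zero}  x∉p = cong (suc ∘ ∣_∣) (∪-identityʳ p)
x∉p⇒∣p∪⁅x⁆∣≡1+∣p∣ {p = inside  ∷ p} {x = Fin.suc x} x∉p = cong suc (x∉p⇒∣p∪⁅x⁆∣≡1+∣p∣ (x∉p ∘ there))
x∉p⇒∣p∪⁅x⁆∣≡1+∣p∣ {p = outside ∷ p} {x = Fin.suc x} x∉p = x∉p⇒∣p∪⁅x⁆∣≡1+∣p∣ (x∉p ∘ there)

x∉p∪q : ∀ {n} {p q : Subset n} {x} → x ∉ p → x ∉ q → x ∉ p ∪ q
x∉p∪q {p = p} {q} x∉p x∉q x∈p∪q with x∈p∪q⁻ p q x∈p∪q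
... | inj₁ x∈p = x∉p x∈p
... | inj₂ x∈q = x∉q x∈q

room-after-move : ∀ {n k c c′} → c′ ≡ suc c → n ≤ suc k + c → n ≤ k + c′
room-after-move {n} {k} {c} refl room = subst (n ≤_) (sym (+-suc k c)) room

module _ {n : ℕ} where

  open import Algebra.Properties.CommutativeSemigroup
    (CommutativeMonoid.commutativeSemigroup (∪-commutativeMonoid n))
    using (xy∙z≈xz∙y)

  ∣[p∪⁅x⁆]∪q∣≡1+∣p∪q∣ : ∀ {p q : Subset n} {x} → x ∉ p → x ∉ q →
                        ∣ (p ∪ ⁅ x ⁆) ∪ q ∣ ≡ suc ∣ p ∪ q ∣
  ∣[p∪⁅x⁆]∪q∣≡1+∣p∪q∣ {p} {q} {x} x∉p x∉q =
    trans (cong ∣_∣ (xy∙z≈xz∙y p ⁅ x ⁆ q)) (x∉p⇒∣p∪⁅x⁆∣≡1+∣p∣ (x∉p∪q x∉p x∉q))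

  ∣p∪[q∪⁅x⁆]∣≡1+∣p∪q∣ : ∀ {p q : Subset n} {x} → x ∉ p → x ∉ q →
                        ∣ p ∪ (q ∪ ⁅ x ⁆) ∣ ≡ suc ∣ p ∪ q ∣
  ∣p∪[q∪⁅x⁆]∣≡1+∣p∪q∣ {p} {q} {x} x∉p x∉q =
    trans (cong ∣_∣ (sym (∪-assoc p q ⁅ x ⁆))) (x∉p⇒∣p∪⁅x⁆∣≡1+∣p∣ (x∉p∪q x∉p x∉q))

module _ {n : ℕ} (G : Graph n) where

  -- Resolver holds at most half of the chosen vertices, up to a slack e, and
  -- strictly less before his own move. From the empty position this holds with
  -- e = 0 if Spoiler moves first, and with e = 1 for either first player.
  Balanced : ℕ → Subset n → Subset n → Player G → Set
  Balanced e R S resolver = ∣ R ∣ + ∣ R ∣ < e + ∣ R ∪ S ∣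
  Balanced e R S spoiler  = ∣ R ∣ + ∣ R ∣ ≤ e + ∣ R ∪ S ∣

  ⊥-balanced-spoiler : ∀ e → Balanced e ⊥ ⊥ spoiler
  ⊥-balanced-spoiler e rewrite ∣⊥∣≡0 n = z≤n

  ⊥-balanced₁ : ∀ p → Balanced 1 ⊥ ⊥ p
  ⊥-balanced₁ resolver rewrite ∣⊥∣≡0 n = s≤s z≤n
  ⊥-balanced₁ spoiler  = ⊥-balanced-spoiler 1

  balanced-resolver-move : ∀ {e R S v} → Free G R S v →
    Balanced e R S resolver → Balanced e (R ∪ ⁅ v ⁆) S spoiler
  balanced-resolver-move {e} {R} {S} (v∉R , v∉S) bal
    rewrite x∉p⇒∣p∪⁅x⁆∣≡1+∣p∣ v∉R | ∣[p∪⁅x⁆]∪q∣≡1+∣p∪q∣ v∉R v∉S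
          | +-suc ∣ R ∣ ∣ R ∣ | +-suc e ∣ R ∪ S ∣ = s≤s bal

  balanced-spoiler-move : ∀ {e R S v} → Free G R S v →
    Balanced e R S spoiler → Balanced e R (S ∪ ⁅ v ⁆) resolver
  balanced-spoiler-move {e} {R} {S} (v∉R , v∉S) bal
    rewrite ∣p∪[q∪⁅x⁆]∣≡1+∣p∪q∣ v∉R v∉S | +-suc e ∣ R ∪ S ∣ = s≤s bal

  balanced⇒∣R∣+∣R∣≤e+n : ∀ {e R S} p → Balanced e R S p → ∣ R ∣ + ∣ R ∣ ≤ e + n
  balanced⇒∣R∣+∣R∣≤e+n {e} {R} {S} p bal =
    ≤-trans (share p bal) (+-monoʳ-≤ e (∣p∣≤n (R ∪ S)))
    where
    share : ∀ p → Balanced e R S p → ∣ R ∣ + ∣ R ∣ ≤ e + ∣ R ∪ S ∣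
    share resolver bal = <⇒≤ bal
    share spoiler  bal = bal

  RWins⇒balanced-resolving-set : ∀ {e R S p} → RWins G R S p → Balanced e R S p →
    ∃[ W ] (Resolving G W × ∣ W ∣ + ∣ W ∣ ≤ e + n)
  RWins⇒balanced-resolving-set {R = R} {p = p} (won res) bal =
    R , res , balanced⇒∣R∣+∣R∣≤e+n p bal
  RWins⇒balanced-resolving-set (rmove v free win) bal =
    RWins⇒balanced-resolving-set win (balanced-resolver-move free bal)
  RWins⇒balanced-resolving-set (smove (v , free) win) bal =
    RWins⇒balanced-resolving-set (win v free) (balanced-spoiler-move free bal)

  free? : ∀ R S v → Dec (Free G R S v)
  free? R S v = ¬? (v ∈? R) ×-dec ¬? (v ∈? S)

  free⇒∣R∪S∣<n : ∀ {R S v} → Free G R S v → ∣ R ∪ S ∣ < n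
  free⇒∣R∪S∣<n {R} {S} {v} (v∉R , v∉S) =
    subst (_≤ n) (x∉p⇒∣p∪⁅x⁆∣≡1+∣p∣ (x∉p∪q v∉R v∉S)) (∣p∣≤n ((R ∪ S) ∪ ⁅ v ⁆))

  module _ {e : ℕ} (large : ∀ W → Resolving G W → e + n < ∣ W ∣ + ∣ W ∣) where

    balanced⇒¬resolving : ∀ {R S} p → Balanced e R S p → ¬ Resolving G R
    balanced⇒¬resolving p bal res =
      <⇒≱ (large _ res) (balanced⇒∣R∣+∣R∣≤e+n p bal)

    -- k bounds the number of free vertices, which every move decreases.
    balanced⇒SWins′ : ∀ k {R S} p → n ≤ k + ∣ R ∪ S ∣ → Balanced e R S p →
      SWins G R S p
    balanced⇒SWins′ zero resolver room bal =
      rmove (balanced⇒¬resolving resolver bal)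
        (λ _ free → ⊥-elim (<⇒≱ (free⇒∣R∪S∣<n free) room))
    balanced⇒SWins′ (suc k) resolver room bal =
      rmove (balanced⇒¬resolving resolver bal) λ where
        _ free@(v∉R , v∉S) → balanced⇒SWins′ k spoiler
          (room-after-move (∣[p∪⁅x⁆]∪q∣≡1+∣p∪q∣ v∉R v∉S) room)
          (balanced-resolver-move free bal)
    balanced⇒SWins′ k {R} {S} spoiler room bal with any? (free? R S)
    ... | no none = over (balanced⇒¬resolving spoiler bal) (λ v free → none (v , free))
    balanced⇒SWins′ zero    spoiler room bal | yes (_ , free) =
      ⊥-elim (<⇒≱ (free⇒∣R∪S∣<n free) room)
    balanced⇒SWins′ (suc k) spoiler room bal | yes (v , free@(v∉R , v∉S)) =
      smove v (balanced⇒¬resolving spoiler bal) free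
        (balanced⇒SWins′ k resolver
          (room-after-move (∣p∪[q∪⁅x⁆]∣≡1+∣p∪q∣ v∉R v∉S) room)
          (balanced-spoiler-move free bal))

    balanced⇒SWins : ∀ {R S} p → Balanced e R S p → SWins G R S p
    balanced⇒SWins p = balanced⇒SWins′ n p (m≤m+n n _)

proposition2p1 : (n : ℕ) → 2 ≤ n → (G : Graph n) → Connected G →
    (d : ℕ) → IsMetricDim G d →
    (OutcomeR G → d ≤ ⌊ n /2⌋) × (⌈ n /2⌉ + 1 ≤ d → OutcomeS G)
proposition2p1 n _ G _ d (_ , d≤dim) = part-i , part-ii
  where
  part-i : OutcomeR G → d ≤ ⌊ n /2⌋
  part-i (_ , wins-S-game)
    with RWins⇒balanced-resolving-set G wins-S-game (⊥-balanced-spoiler G 0)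
  ... | W , resolving , small = ≤-trans (d≤dim W resolving) (k+k≤n⇒k≤⌊n/2⌋ small)

  part-ii : ⌈ n /2⌉ + 1 ≤ d → OutcomeS G
  part-ii large-dim = wins resolver , wins spoiler
    where
    wins : ∀ p → SWins G ⊥ ⊥ p
    wins p = balanced⇒SWins G
      (λ W resolving → ⌈n/2⌉+1≤k⇒1+n<k+k (≤-trans large-dim (d≤dim W resolving)))
      p (⊥-balanced₁ G p)
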